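{- For all $n\ge1$ and $d\ge3$, $m^*_{d,n}=\left\lfloor\frac{(d-1)(n-1)}{2}\right\rfloor$, where $m^*_{d,n}$ is defined in the context.
   Context: $S_n$ is the set of permutations of $\{0,\dots,n-1\}$ in one-line notation. $S^d_n$ is the set of $(d-1)$-tuples $\Pi=(\pi^2,\dots,\pi^d)$ of elements of $S_n$, with elements (columns) $\Pi_j=(\pi^2_j,\dots,\pi^d_j)^T$. The (sum) level is $\mathrm{lev}(\Pi_j)=\pi^2_j+\dots+\pi^d_j$ and $\mathrm{lev}_{\min}(\Pi)=\min_j\mathrm{lev}(\Pi_j)$. Define $m^*_{d,n}=\max\{\mathrm{lev}_{\min}(\Pi):\Pi\in S^d_n\}$. -}

module Defs where

open import Data.Nat using (ℕ; _+_; _≤_; _∸_)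
open import Data.Fin using (Fin; toℕ)
open import Data.Fin.Permutation using (Permutation′; _⟨$⟩ʳ_)
open import Data.Vec.Functional using (Vector; foldr)
open import Data.Product using (Σ; ∃; _×_)
open import Relation.Binary.PropositionalEquality using (_≡_)

-- S_n : permutations of {0,…,n-1} (as Fin n), one-line notation π_j = π ⟨$⟩ʳ j.
-- S^d_n : (d-1)-tuples (π^2,…,π^d) of permutations, indexed by Fin (d ∸ 1).
Tuple : ℕ → ℕ → Set
Tuple d n = Vector (Permutation′ n) (d ∸ 1)

lev : ∀ d {n} → Tuple d n → Fin n → ℕ
lev d Π j = foldr (λ π acc → toℕ (π ⟨$⟩ʳ j) + acc) 0 Π

IsLevMin : ∀ d {n} → Tuple d n → ℕ → Set
IsLevMin d Π m = (∃ λ j → lev d Π j ≡ m) × (∀ j → m ≤ lev d Π j)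

IsMStar : ℕ → ℕ → ℕ → Set
IsMStar d n m = (Σ (Tuple d n) λ Π → IsLevMin d Π m)
              × (∀ (Π : Tuple d n) l → IsLevMin d Π l → l ≤ m)

-- Every row of Π is a permutation of 0, …, n-1, so the levels of the n columns add up to
-- (d-1)·n(n-1)/2 and the smallest one is at most ⌊(d-1)(n-1)/2⌋.  Conversely, the pair
-- (id, reverse) has every level equal to n-1, which settles odd d.  For even d one triple
-- with all levels ≥ ⌊3(n-1)/2⌋ suffices: put 0, 1, …, n-1 in the last row and let the
-- other two rows descend through the lower and the upper block of values at the even and
-- at the odd positions, the two rows using the blocks in opposite roles.  With E even and
-- O odd positions, every column then has level 2E + O - 2 or E + 2O - 1.
module Submission where

open import Defs

open import Data.Nat
open import Data.Nat.Properties
open import Data.Nat.DivMod using (m*n/n≡m; /-mono-≤; m<n*o⇒m/o<n)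
open import Data.Nat.Solver using (module +-*-Solver)
open import Data.Fin using (Fin; zero; suc; toℕ; opposite)
open import Data.Fin.Properties
  using (opposite-prop; toℕ<n; +↔⊎; toℕ-cast; toℕ-↑ˡ; toℕ-↑ʳ; ¬∀⟶∃¬)
open import Data.Fin.Permutation using (_⟨$⟩ʳ_; id; reverse; cast-id)
open import Data.Vec.Functional using ([]; _∷_; head; tail)
open import Data.Product using (∃; _,_)
open import Data.Sum using (_⊎_; inj₁; inj₂)
import Data.Sum as Sum
open import Data.Sum.Algebra using (⊎-comm)
open import Data.Sum.Function.Propositional using (_⊎-↔_)
open import Function.Base using (_∘_)
open import Function.Bundles using (_↔_; mk↔ₛ′; Inverse)
open import Function.Properties.Inverse using (↔-trans; ↔-sym)
open import Relation.Binary.PropositionalEquality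
open import Algebra.Properties.CommutativeMonoid.Sum +-0-commutativeMonoid
  using (sum; sum-permute; ∑-distrib-+; sum-cong-≗)

open +-*-Solver
open Inverse using (to; from)

2*m≤n⇒m≤n/2 : ∀ {m n} → 2 * m ≤ n → m ≤ n / 2
2*m≤n⇒m≤n/2 {m} {n} 2m≤n =
  subst (_≤ n / 2) (m*n/n≡m m 2) (/-mono-≤ (subst (_≤ n) (*-comm 2 m) 2m≤n) ≤-refl)

m≤1+2*n⇒m/2≤n : ∀ {m n} → m ≤ suc (2 * n) → m / 2 ≤ n
m≤1+2*n⇒m/2≤n {m} {n} m≤1+2n =
  s≤s⁻¹ (m<n*o⇒m/o<n (≤-trans (s≤s m≤1+2n) (≤-reflexive (cong (2 +_) (*-comm 2 n)))))

sum-const : ∀ n c → sum {n} (λ _ → c) ≡ n * c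
sum-const zero    c = refl
sum-const (suc n) c = cong (c +_) (sum-const n c)

*≤sum : ∀ {n} (f : Fin n → ℕ) {c} → (∀ i → c ≤ f i) → n * c ≤ sum f
*≤sum {zero}  f c≤f = z≤n
*≤sum {suc n} f c≤f = +-mono-≤ (c≤f zero) (*≤sum (f ∘ suc) (c≤f ∘ suc))

toℕ+toℕ-opposite : ∀ {n} (i : Fin n) → toℕ i + toℕ (opposite i) ≡ n ∸ 1
toℕ+toℕ-opposite {suc n} i =
  trans (cong (toℕ i +_) (opposite-prop i)) (m+[n∸m]≡n (s≤s⁻¹ (toℕ<n i)))

2*sum-toℕ : ∀ n → 2 * sum {n} toℕ ≡ n * (n ∸ 1)
2*sum-toℕ n = begin
  2 * ∑ toℕ                              ≡⟨ cong (∑ toℕ +_) (+-identityʳ (∑ toℕ)) ⟩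
  ∑ toℕ + ∑ toℕ                          ≡⟨ cong (∑ toℕ +_) (sum-permute {n} toℕ reverse) ⟩
  ∑ toℕ + ∑ (toℕ ∘ opposite)             ≡⟨ sym (∑-distrib-+ {n} toℕ (toℕ ∘ opposite)) ⟩
  ∑ (λ i → toℕ i + toℕ (opposite i))     ≡⟨ sum-cong-≗ (toℕ+toℕ-opposite {n}) ⟩
  ∑ (λ _ → n ∸ 1)                        ≡⟨ sum-const n (n ∸ 1) ⟩
  n * (n ∸ 1)                            ∎
  where
  open ≡-Reasoning
  ∑ : (Fin n → ℕ) → ℕ
  ∑ = sum

sum-lev : ∀ {m n} (Π : Tuple (suc m) n) → sum (lev (suc m) Π) ≡ m * sum {n} toℕ
sum-lev {zero}  {n} Π = trans (sum-const n 0) (*-zeroʳ n)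
sum-lev {suc m} {n} Π = begin
  ∑ (lev (2 + m) Π)                                       ≡⟨ ∑-distrib-+ (toℕ ∘ (head Π ⟨$⟩ʳ_)) _ ⟩
  ∑ (toℕ ∘ (head Π ⟨$⟩ʳ_)) + ∑ (lev (suc m) (tail Π))     ≡⟨ cong₂ _+_ (sym (sum-permute toℕ (head Π))) (sum-lev (tail Π)) ⟩
  ∑ toℕ + m * ∑ toℕ                                       ∎
  where
  open ≡-Reasoning
  ∑ : (Fin n → ℕ) → ℕ
  ∑ = sum

lev-lowerBound≤half : ∀ {m n} (Π : Tuple (suc m) (suc n)) {c} → (∀ j → c ≤ lev (suc m) Π j) → c ≤ m * n / 2
lev-lowerBound≤half {m} {n} Π {c} c≤lev = 2*m≤n⇒m≤n/2 (*-cancelˡ-≤ (suc n) (begin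
  suc n * (2 * c)                ≡⟨ solve 2 (λ k c → k :* (con 2 :* c) := con 2 :* (k :* c)) refl (suc n) c ⟩
  2 * (suc n * c)                ≤⟨ *-monoʳ-≤ 2 (*≤sum (lev (suc m) Π) c≤lev) ⟩
  2 * sum (lev (suc m) Π)        ≡⟨ cong (2 *_) (sum-lev Π) ⟩
  2 * (m * S)                    ≡⟨ solve 2 (λ m s → con 2 :* (m :* s) := m :* (con 2 :* s)) refl m S ⟩
  m * (2 * S)                    ≡⟨ cong (m *_) (2*sum-toℕ (suc n)) ⟩
  m * (suc n * n)                ≡⟨ solve 3 (λ m k n → m :* (k :* n) := k :* (m :* n)) refl m (suc n) n ⟩
  suc n * (m * n)                ∎))
  where
  open ≤-Reasoning
  S = sum {suc n} toℕ

lev-id∷reverse : ∀ {m n} (Π : Tuple (suc m) n) j →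
                 lev (3 + m) (id ∷ reverse ∷ Π) j ≡ (n ∸ 1) + lev (suc m) Π j
lev-id∷reverse {m} Π j =
  trans (sym (+-assoc (toℕ j) _ _)) (cong (_+ lev (suc m) Π j) (toℕ+toℕ-opposite j))

evenOdd : ∀ {n} → Fin ⌈ n /2⌉ ⊎ Fin ⌊ n /2⌋ → Fin n
evenOdd {suc n}       (inj₁ zero)    = zero
evenOdd {suc (suc n)} (inj₁ (suc i)) = suc (suc (evenOdd (inj₁ i)))
evenOdd {suc (suc n)} (inj₂ zero)    = suc zero
evenOdd {suc (suc n)} (inj₂ (suc i)) = suc (suc (evenOdd (inj₂ i)))

evenOdd⁻¹ : ∀ {n} → Fin n → Fin ⌈ n /2⌉ ⊎ Fin ⌊ n /2⌋
evenOdd⁻¹ {suc n}       zero          = inj₁ zero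
evenOdd⁻¹ {suc (suc n)} (suc zero)    = inj₂ zero
evenOdd⁻¹ {suc (suc n)} (suc (suc i)) = Sum.map suc suc (evenOdd⁻¹ i)

evenOdd-map-suc : ∀ {n} (x : Fin ⌈ n /2⌉ ⊎ Fin ⌊ n /2⌋) →
                  evenOdd (Sum.map suc suc x) ≡ suc (suc (evenOdd x))
evenOdd-map-suc (inj₁ i) = refl
evenOdd-map-suc (inj₂ i) = refl

evenOdd-evenOdd⁻¹ : ∀ {n} (i : Fin n) → evenOdd (evenOdd⁻¹ i) ≡ i
evenOdd-evenOdd⁻¹ {suc n}       zero          = refl
evenOdd-evenOdd⁻¹ {suc (suc n)} (suc zero)    = refl
evenOdd-evenOdd⁻¹ {suc (suc n)} (suc (suc i)) =
  trans (evenOdd-map-suc (evenOdd⁻¹ i)) (cong (λ k → suc (suc k)) (evenOdd-evenOdd⁻¹ i))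

evenOdd⁻¹-evenOdd : ∀ {n} (x : Fin ⌈ n /2⌉ ⊎ Fin ⌊ n /2⌋) → evenOdd⁻¹ (evenOdd x) ≡ x
evenOdd⁻¹-evenOdd {suc n}       (inj₁ zero)    = refl
evenOdd⁻¹-evenOdd {suc (suc n)} (inj₁ (suc i)) = cong (Sum.map suc suc) (evenOdd⁻¹-evenOdd (inj₁ i))
evenOdd⁻¹-evenOdd {suc (suc n)} (inj₂ zero)    = refl
evenOdd⁻¹-evenOdd {suc (suc n)} (inj₂ (suc i)) = cong (Sum.map suc suc) (evenOdd⁻¹-evenOdd (inj₂ i))

evenOdd↔ : ∀ {n} → (Fin ⌈ n /2⌉ ⊎ Fin ⌊ n /2⌋) ↔ Fin n
evenOdd↔ = mk↔ₛ′ evenOdd evenOdd⁻¹ evenOdd-evenOdd⁻¹ evenOdd⁻¹-evenOdd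

toℕ-evenOdd-inj₁ : ∀ {n} (i : Fin ⌈ n /2⌉) → toℕ (evenOdd {n} (inj₁ i)) ≡ 2 * toℕ i
toℕ-evenOdd-inj₁ {suc n}       zero    = refl
toℕ-evenOdd-inj₁ {suc (suc n)} (suc i) =
  trans (cong (λ k → suc (suc k)) (toℕ-evenOdd-inj₁ i)) (sym (*-suc 2 (toℕ i)))

toℕ-evenOdd-inj₂ : ∀ {n} (i : Fin ⌊ n /2⌋) → toℕ (evenOdd {n} (inj₂ i)) ≡ suc (2 * toℕ i)
toℕ-evenOdd-inj₂ {suc (suc n)} zero    = refl
toℕ-evenOdd-inj₂ {suc (suc n)} (suc i) =
  trans (cong (λ k → suc (suc k)) (toℕ-evenOdd-inj₂ i)) (cong suc (sym (*-suc 2 (toℕ i))))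

reversedBlocks : ∀ {k l n} → k + l ≡ n → (Fin k ⊎ Fin l) ↔ Fin n
reversedBlocks eq = ↔-trans (reverse ⊎-↔ reverse) (↔-trans (↔-sym +↔⊎) (cast-id eq))

toℕ-reversedBlocks-inj₁ : ∀ {k l n} (eq : k + l ≡ n) (i : Fin k) →
                          toℕ (to (reversedBlocks eq) (inj₁ i)) ≡ toℕ (opposite i)
toℕ-reversedBlocks-inj₁ {l = l} eq i = trans (toℕ-cast eq _) (toℕ-↑ˡ (opposite i) l)

toℕ-reversedBlocks-inj₂ : ∀ {k l n} (eq : k + l ≡ n) (i : Fin l) →
                          toℕ (to (reversedBlocks eq) (inj₂ i)) ≡ k + toℕ (opposite i)
toℕ-reversedBlocks-inj₂ {k} eq i = trans (toℕ-cast eq _) (toℕ-↑ʳ k (opposite i))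

tripleVia : ∀ {I : Set} {n} (α β σ : I ↔ Fin n) → Tuple 4 n
tripleVia α β σ = ↔-trans (↔-sym σ) α ∷ ↔-trans (↔-sym σ) β ∷ ↔-trans (↔-sym σ) σ ∷ []

lev-tripleVia : ∀ {I : Set} {n} (α β σ : I ↔ Fin n) j → let i = from σ j in
                lev 4 (tripleVia α β σ) j ≡ toℕ (to α i) + toℕ (to β i) + toℕ (to σ i)
lev-tripleVia α β σ j = trans (cong (λ x → a + (b + x)) (+-identityʳ c)) (sym (+-assoc a b c))
  where
  a = toℕ (to α (from σ j))
  b = toℕ (to β (from σ j))
  c = toℕ (to σ (from σ j))

evenColumn-bound : ∀ {E O} (s : Fin E) → O ≤ E →
                   3 * (E + O ∸ 1) ≤ suc (2 * (toℕ (opposite s) + (O + toℕ (opposite s)) + 2 * toℕ s))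
evenColumn-bound {suc E} {O} s O≤E = begin
  3 * (E + O)                            ≡⟨ cong (λ e → 3 * (e + O)) (sym x+r≡E) ⟩
  3 * (x + r + O)                        ≡⟨ solve 3 (λ x r o → con 3 :* (x :+ r :+ o) := con 3 :* (x :+ r) :+ con 2 :* o :+ o) refl x r O ⟩
  3 * (x + r) + 2 * O + O                ≤⟨ +-monoʳ-≤ (3 * (x + r) + 2 * O) (≤-trans O≤E (s≤s (≤-reflexive (sym x+r≡E)))) ⟩
  3 * (x + r) + 2 * O + suc (x + r)      ≡⟨ solve 3 (λ x r o → con 3 :* (x :+ r) :+ con 2 :* o :+ (con 1 :+ (x :+ r)) := con 1 :+ con 2 :* (r :+ (o :+ r) :+ con 2 :* x)) refl x r O ⟩
  suc (2 * (r + (O + r) + 2 * x))        ∎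
  where
  open ≤-Reasoning
  x = toℕ s
  r = toℕ (opposite s)
  x+r≡E : x + r ≡ E
  x+r≡E = toℕ+toℕ-opposite s

oddColumn-bound : ∀ {E O} (t : Fin O) → E ≤ suc O →
                  3 * (E + O ∸ 1) ≤ suc (2 * (E + toℕ (opposite t) + toℕ (opposite t) + suc (2 * toℕ t)))
oddColumn-bound {E} {suc O} t E≤1+O = begin
  3 * (E + suc O ∸ 1)                    ≡⟨ cong (λ k → 3 * (k ∸ 1)) (+-suc E O) ⟩
  3 * (E + O)                            ≡⟨ cong (λ o → 3 * (E + o)) (sym x+r≡O) ⟩
  3 * (E + (x + r))                      ≡⟨ solve 3 (λ e x r → con 3 :* (e :+ (x :+ r)) := con 2 :* e :+ e :+ con 3 :* (x :+ r)) refl E x r ⟩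
  2 * E + E + 3 * (x + r)                ≤⟨ +-monoˡ-≤ (3 * (x + r)) (+-monoʳ-≤ (2 * E) (≤-trans E≤1+O (≤-reflexive (cong (2 +_) (sym x+r≡O))))) ⟩
  2 * E + (2 + (x + r)) + 3 * (x + r)    ≤⟨ n≤1+n _ ⟩
  suc (2 * E + (2 + (x + r)) + 3 * (x + r)) ≡⟨ solve 3 (λ e x r → con 1 :+ (con 2 :* e :+ (con 2 :+ (x :+ r)) :+ con 3 :* (x :+ r)) := con 1 :+ con 2 :* (e :+ r :+ r :+ (con 1 :+ con 2 :* x))) refl E x r ⟩
  suc (2 * (E + r + r + suc (2 * x)))    ∎
  where
  open ≤-Reasoning
  x = toℕ t
  r = toℕ (opposite t)
  x+r≡O : x + r ≡ O
  x+r≡O = toℕ+toℕ-opposite t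

⌈n/2⌉+⌊n/2⌋≡n : ∀ n → ⌈ n /2⌉ + ⌊ n /2⌋ ≡ n
⌈n/2⌉+⌊n/2⌋≡n n = trans (+-comm ⌈ n /2⌉ ⌊ n /2⌋) (⌊n/2⌋+⌈n/2⌉≡n n)

evensLow↔ evensHigh↔ : ∀ n → (Fin ⌈ n /2⌉ ⊎ Fin ⌊ n /2⌋) ↔ Fin n
evensLow↔  n = reversedBlocks (⌈n/2⌉+⌊n/2⌋≡n n)
evensHigh↔ n = ↔-trans (⊎-comm _ _) (reversedBlocks (⌊n/2⌋+⌈n/2⌉≡n n))

-- Column 2s of the triple is (⌈n/2⌉-1-s, n-1-s, 2s) and column 2t+1 is (n-1-t, ⌊n/2⌋-1-t, 2t+1).
balancedTriple : ∀ n → Tuple 4 n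
balancedTriple n = tripleVia (evensLow↔ n) (evensHigh↔ n) evenOdd↔

lev-balancedTriple : ∀ n j → 3 * (n ∸ 1) ≤ suc (2 * lev 4 (balancedTriple n) j)
lev-balancedTriple n j =
  subst (Bound n) (sym (lev-tripleVia (evensLow↔ n) (evensHigh↔ n) evenOdd↔ j)) (column (evenOdd⁻¹ j))
  where
  Bound : ℕ → ℕ → Set
  Bound k x = 3 * (k ∸ 1) ≤ suc (2 * x)
  column : ∀ i → Bound n (toℕ (to (evensLow↔ n) i) + toℕ (to (evensHigh↔ n) i) + toℕ (evenOdd {n} i))
  column (inj₁ s) = subst₂ Bound (⌈n/2⌉+⌊n/2⌋≡n n)
    (sym (cong₂ _+_ (cong₂ _+_ (toℕ-reversedBlocks-inj₁ (⌈n/2⌉+⌊n/2⌋≡n n) s)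
                               (toℕ-reversedBlocks-inj₂ (⌊n/2⌋+⌈n/2⌉≡n n) s))
                    (toℕ-evenOdd-inj₁ s)))
    (evenColumn-bound s (⌊n/2⌋≤⌈n/2⌉ n))
  column (inj₂ t) = subst₂ Bound (⌈n/2⌉+⌊n/2⌋≡n n)
    (sym (cong₂ _+_ (cong₂ _+_ (toℕ-reversedBlocks-inj₂ (⌈n/2⌉+⌊n/2⌋≡n n) t)
                               (toℕ-reversedBlocks-inj₁ (⌊n/2⌋+⌈n/2⌉≡n n) t))
                    (toℕ-evenOdd-inj₂ t)))
    (oddColumn-bound t (⌊n/2⌋-mono (n≤1+n (suc n))))

balanced : ∀ m {n} → Tuple (3 + m) n
balanced zero          = id ∷ reverse ∷ []
balanced (suc zero)    = balancedTriple _
balanced (suc (suc m)) = id ∷ reverse ∷ balanced m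

-- k ≤ 1 + 2x says x ≥ ⌊k/2⌋ without division, so that each added pair simply adds n-1.
lev-balanced : ∀ m {n} j → (2 + m) * (n ∸ 1) ≤ suc (2 * lev (3 + m) (balanced m {n}) j)
lev-balanced zero          {n} j = ≤-trans (≤-reflexive (cong (2 *_) level≡n∸1)) (n≤1+n _)
  where
  level≡n∸1 : n ∸ 1 ≡ lev 3 (balanced zero) j
  level≡n∸1 = sym (trans (lev-id∷reverse {n = n} [] j) (+-identityʳ (n ∸ 1)))
lev-balanced (suc zero)    {n} j = lev-balancedTriple n j
lev-balanced (suc (suc m)) {n} j = begin
  (4 + m) * N                 ≡⟨ solve 2 (λ m N → (con 4 :+ m) :* N := (con 2 :+ m) :* N :+ con 2 :* N) refl m N ⟩
  (2 + m) * N + 2 * N         ≤⟨ +-monoˡ-≤ (2 * N) (lev-balanced m j) ⟩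
  suc (2 * L) + 2 * N         ≡⟨ solve 2 (λ L N → con 1 :+ con 2 :* L :+ con 2 :* N := con 1 :+ con 2 :* (N :+ L)) refl L N ⟩
  suc (2 * (N + L))           ≡⟨ cong (λ x → suc (2 * x)) (sym (lev-id∷reverse (balanced m) j)) ⟩
  suc (2 * lev (5 + m) (balanced (2 + m)) j) ∎
  where
  open ≤-Reasoning
  N = n ∸ 1
  L = lev (3 + m) (balanced m) j

theorem4p7 : ∀ (n d : ℕ) → 1 ≤ n → 3 ≤ d →
    IsMStar d n (((d ∸ 1) * (n ∸ 1)) / 2)
theorem4p7 zero    d                   ()  _
theorem4p7 (suc n) zero                _   ()
theorem4p7 (suc n) (suc zero)          _   (s≤s ())
theorem4p7 (suc n) (suc (suc zero))    _   (s≤s (s≤s ()))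
theorem4p7 (suc n) (suc (suc (suc m))) _   _ = (Π , attained , bounded) , upper
  where
  Π = balanced m
  M = (2 + m) * n / 2
  bounded : ∀ j → M ≤ lev (3 + m) Π j
  bounded j = m≤1+2*n⇒m/2≤n (lev-balanced m j)
  attained : ∃ λ j → lev (3 + m) Π j ≡ M
  attained with ¬∀⟶∃¬ (suc n) (λ j → M < lev (3 + m) Π j) (λ j → M <? lev (3 + m) Π j)
                      (λ M<lev → n≮n M (lev-lowerBound≤half Π M<lev))
  ... | j , M≮lev = j , ≤-antisym (≮⇒≥ M≮lev) (bounded j)
  upper : ∀ Π′ l → IsLevMin (3 + m) Π′ l → l ≤ M
  upper Π′ l (_ , l≤lev) = lev-lowerBound≤half Π′ l≤lev
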